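{- Let $r\ge 2$ and $n\ge 2r+1$ be integers. Then $H_{n:r}$ is connected.
   Context: For positive integers $n,r$ write $[n]=\{1,\dots,n\}$. The Häggkvist–Hell graph $H_{n:r}$ is the graph whose vertices are the ordered pairs $(h,T)$ where $T$ is an $r$-element subset of $[n]$ and $h\in[n]\setminus T$; two vertices $(h_x,T_x)$ and $(h_y,T_y)$ are adjacent iff $h_x\in T_y$, $h_y\in T_x$ and $T_x\cap T_y=\varnothing$. -}

module Defs where

open import Data.Nat using (ℕ)
open import Data.Fin using (Fin)
open import Data.Fin.Subset using (Subset; _∈_; _∉_; _∩_; ∣_∣; Empty)
open import Data.Product using (_×_)
open import Relation.Binary.PropositionalEquality using (_≡_)
open import Relation.Binary.Construct.Closure.ReflexiveTransitive using (Star)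

-- The ground set [n] is represented by Fin n.
-- A vertex of H_{n:r}: a pair (h , T) with T an r-element subset of [n] and h ∉ T.
record Vertex (n r : ℕ) : Set where
  constructor vtx
  field
    head    : Fin n
    tail    : Subset n
    tailCard : ∣ tail ∣ ≡ r
    headNotInTail : head ∉ tail
open Vertex public

Adj : {n r : ℕ} → Vertex n r → Vertex n r → Set
Adj x y = (head x ∈ tail y) × (head y ∈ tail x) × Empty (tail x ∩ tail y)

Connected : (n r : ℕ) → Set
Connected n r = (x y : Vertex n r) → Star (Adj {n} {r}) x y

module Submission where

-- Everything rests on one counting fact about finite sets: between subsets
-- R ⊆ X there is a subset of every size from ∣R∣ to ∣X∣ (intermediateSubset).
-- It yields neighbours on demand: a vertex (h , T) has, for every a ∈ T, a
-- neighbour (a , S) whose tail S is any r-set with h ∈ S disjoint from T, so we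
-- can prescribe up to r elements of S (neighbourWithin).  With n ≥ 2r+1 two
-- vertices (h , T), (h , T') with the same head, a common tail element a and
-- ∣T ∪ T'∣ ≤ r+1 are joined by a walk of length two through (a , S), S avoiding
-- T ∪ T' (twoStep).  Repeated exchanges of one tail element then join any two
-- vertices with the same head (sameHead); a vertex (h , T) reaches every vertex
-- whose head lies in T by one step plus sameHead (headInTail); and an arbitrary
-- vertex first steps to a neighbour whose tail contains the target head.

open import Defs
open import Data.Nat using (ℕ; zero; suc; _≤_; _<_; _*_; _+_; z≤n; s≤s; s≤s⁻¹; _≤?_)
open import Data.Nat.Properties
open import Data.Fin using (Fin)
open import Data.Fin.Subset
  using (Subset; inside; outside; _∈_; _∉_; _∩_; _∪_; ∁; ∣_∣; ⊥; Empty; Nonempty; _⊆_; ⁅_⁆)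
open import Data.Fin.Subset.Properties
  using ( _∈?_; p⊆q⇒∣p∣≤∣q∣; ∣∁p∣≡n∸∣p∣; x∈p⇒x∉∁p; x∉p⇒x∈∁p; x∈p∪q⁻; x∈p∩q⁻; x∈p∩q⁺; p∩q⊆p; p∩q⊆q
        ; p⊆p∪q; q⊆p∪q; ∣p∣≤∣p∪q∣; x∈⁅x⁆; x∈⁅y⁆⇒x≡y; ∣⁅x⁆∣≡1; Empty-unique; ∣⊥∣≡0; ∩-comm
        ; drop-∷-⊆; out⊆; s⊆s; p⊆q⇒∁p⊇∁q)
open import Data.Vec using ([]; _∷_; here; there)
open import Data.Product using (Σ; ∃; _×_; _,_; proj₁; proj₂)
open import Data.Sum using (inj₁; inj₂; [_,_]′)
open import Function using (_∘_; id)
open import Relation.Nullary using (Dec; yes; no; contradiction)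
open import Relation.Binary.PropositionalEquality using (_≡_; refl; sym; trans; cong; cong₂; subst; subst₂; module ≡-Reasoning)
open import Relation.Binary.Construct.Closure.ReflexiveTransitive using (Star; ε; _◅_; _◅◅_)

private
  variable
    n : ℕ

∣p∪q∣+∣p∩q∣≡∣p∣+∣q∣ : (p q : Subset n) → ∣ p ∪ q ∣ + ∣ p ∩ q ∣ ≡ ∣ p ∣ + ∣ q ∣
∣p∪q∣+∣p∩q∣≡∣p∣+∣q∣ [] [] = refl
∣p∪q∣+∣p∩q∣≡∣p∣+∣q∣ (inside ∷ p) (inside ∷ q) =
  cong suc (trans (+-suc _ _) (trans (cong suc (∣p∪q∣+∣p∩q∣≡∣p∣+∣q∣ p q)) (sym (+-suc _ _))))
∣p∪q∣+∣p∩q∣≡∣p∣+∣q∣ (inside ∷ p) (outside ∷ q) = cong suc (∣p∪q∣+∣p∩q∣≡∣p∣+∣q∣ p q)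
∣p∪q∣+∣p∩q∣≡∣p∣+∣q∣ (outside ∷ p) (inside ∷ q) =
  trans (cong suc (∣p∪q∣+∣p∩q∣≡∣p∣+∣q∣ p q)) (sym (+-suc _ _))
∣p∪q∣+∣p∩q∣≡∣p∣+∣q∣ (outside ∷ p) (outside ∷ q) = ∣p∪q∣+∣p∩q∣≡∣p∣+∣q∣ p q

∣p∪q∣≤∣p∣+∣q∣ : (p q : Subset n) → ∣ p ∪ q ∣ ≤ ∣ p ∣ + ∣ q ∣
∣p∪q∣≤∣p∣+∣q∣ p q = subst (∣ p ∪ q ∣ ≤_) (∣p∪q∣+∣p∩q∣≡∣p∣+∣q∣ p q) (m≤m+n _ _)

disjoint⇒∣p∪q∣≡∣p∣+∣q∣ : (p q : Subset n) → Empty (p ∩ q) → ∣ p ∪ q ∣ ≡ ∣ p ∣ + ∣ q ∣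
disjoint⇒∣p∪q∣≡∣p∣+∣q∣ {n} p q disjoint = begin
  ∣ p ∪ q ∣                 ≡⟨ sym (+-identityʳ _) ⟩
  ∣ p ∪ q ∣ + 0             ≡⟨ cong (∣ p ∪ q ∣ +_) (sym (∣⊥∣≡0 n)) ⟩
  ∣ p ∪ q ∣ + ∣ ⊥ {n = n} ∣ ≡⟨ cong (λ s → ∣ p ∪ q ∣ + ∣ s ∣) (sym (Empty-unique disjoint)) ⟩
  ∣ p ∪ q ∣ + ∣ p ∩ q ∣     ≡⟨ ∣p∪q∣+∣p∩q∣≡∣p∣+∣q∣ p q ⟩
  ∣ p ∣ + ∣ q ∣             ∎
  where open ≡-Reasoning

∣p∪⁅x⁆∣≤1+∣p∣ : (p : Subset n) (x : Fin n) → ∣ p ∪ ⁅ x ⁆ ∣ ≤ suc ∣ p ∣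
∣p∪⁅x⁆∣≤1+∣p∣ p x =
  ≤-trans (∣p∪q∣≤∣p∣+∣q∣ p ⁅ x ⁆) (≤-reflexive (trans (cong (∣ p ∣ +_) (∣⁅x⁆∣≡1 x)) (+-comm _ 1)))

x∉p⇒∣p∪⁅x⁆∣≡1+∣p∣ : (p : Subset n) {x : Fin n} → x ∉ p → ∣ p ∪ ⁅ x ⁆ ∣ ≡ suc ∣ p ∣
x∉p⇒∣p∪⁅x⁆∣≡1+∣p∣ p {x} x∉p =
  trans (disjoint⇒∣p∪q∣≡∣p∣+∣q∣ p ⁅ x ⁆ x∉p∩⁅x⁆) (trans (cong (∣ p ∣ +_) (∣⁅x⁆∣≡1 x)) (+-comm _ 1))
  where
  x∉p∩⁅x⁆ : Empty (p ∩ ⁅ x ⁆)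
  x∉p∩⁅x⁆ (y , y∈) with x∈p∩q⁻ p ⁅ x ⁆ y∈
  ... | y∈p , y∈⁅x⁆ = x∉p (subst (_∈ p) (x∈⁅y⁆⇒x≡y x y∈⁅x⁆) y∈p)

∣p∣>0⇒Nonempty : (p : Subset n) → 0 < ∣ p ∣ → Nonempty p
∣p∣>0⇒Nonempty (inside ∷ p) _ = Fin.zero , here
∣p∣>0⇒Nonempty (outside ∷ p) ∣p∣>0 with ∣p∣>0⇒Nonempty p ∣p∣>0
... | x , x∈p = Fin.suc x , there x∈p

∣p∩q∣<∣p∣⇒p⊈q : (p q : Subset n) → ∣ p ∩ q ∣ < ∣ p ∣ → ∃ λ x → x ∈ p × x ∉ q
∣p∩q∣<∣p∣⇒p⊈q (inside ∷ p) (outside ∷ q) _ = Fin.zero , here , λ ()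
∣p∩q∣<∣p∣⇒p⊈q (inside ∷ p) (inside ∷ q) (s≤s lt) with ∣p∩q∣<∣p∣⇒p⊈q p q lt
... | x , x∈p , x∉q = Fin.suc x , there x∈p , λ { (there x∈q) → x∉q x∈q }
∣p∩q∣<∣p∣⇒p⊈q (outside ∷ p) (_ ∷ q) lt with ∣p∩q∣<∣p∣⇒p⊈q p q lt
... | x , x∈p , x∉q = Fin.suc x , there x∈p , λ { (there x∈q) → x∉q x∈q }

intermediateSubset : (R X : Subset n) (k : ℕ) → R ⊆ X → ∣ R ∣ ≤ k → k ≤ ∣ X ∣ →
                     Σ (Subset n) λ Y → R ⊆ Y × Y ⊆ X × ∣ Y ∣ ≡ k
intermediateSubset [] [] k _ _ k≤0 = [] , (λ ()) , (λ ()) , sym (n≤0⇒n≡0 k≤0)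
intermediateSubset (inside ∷ R) (outside ∷ X) k R⊆X _ _ with R⊆X here
... | ()
intermediateSubset (outside ∷ R) (outside ∷ X) k R⊆X ∣R∣≤k k≤∣X∣
  with intermediateSubset R X k (drop-∷-⊆ R⊆X) ∣R∣≤k k≤∣X∣
... | Y , R⊆Y , Y⊆X , ∣Y∣≡k = outside ∷ Y , out⊆ R⊆Y , out⊆ Y⊆X , ∣Y∣≡k
intermediateSubset (inside ∷ R) (inside ∷ X) (suc k) R⊆X (s≤s ∣R∣≤k) (s≤s k≤∣X∣)
  with intermediateSubset R X k (drop-∷-⊆ R⊆X) ∣R∣≤k k≤∣X∣
... | Y , R⊆Y , Y⊆X , ∣Y∣≡k = inside ∷ Y , s⊆s R⊆Y , s⊆s Y⊆X , cong suc ∣Y∣≡k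
intermediateSubset (outside ∷ R) (inside ∷ X) k R⊆X ∣R∣≤k k≤1+∣X∣ with k ≤? ∣ X ∣
... | yes k≤∣X∣ with intermediateSubset R X k (drop-∷-⊆ R⊆X) ∣R∣≤k k≤∣X∣
...   | Y , R⊆Y , Y⊆X , ∣Y∣≡k = outside ∷ Y , out⊆ R⊆Y , out⊆ Y⊆X , ∣Y∣≡k
intermediateSubset (outside ∷ R) (inside ∷ X) zero _ _ _ | no 0≰∣X∣ = contradiction z≤n 0≰∣X∣
intermediateSubset (outside ∷ R) (inside ∷ X) (suc k) R⊆X _ (s≤s k≤∣X∣) | no k≰∣X∣
  with intermediateSubset R X k (drop-∷-⊆ R⊆X) ∣R∣≤k k≤∣X∣
  where
  -- here ∣X∣ < 1+k, so ∣R∣ ≤ ∣X∣ ≤ k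
  ∣R∣≤k : ∣ R ∣ ≤ k
  ∣R∣≤k = ≤-trans (p⊆q⇒∣p∣≤∣q∣ (drop-∷-⊆ R⊆X)) (s≤s⁻¹ (≰⇒> k≰∣X∣))
... | Y , R⊆Y , Y⊆X , ∣Y∣≡k = inside ∷ Y , out⊆ R⊆Y , s⊆s Y⊆X , cong suc ∣Y∣≡k

∪-lub : {p q s : Subset n} → p ⊆ s → q ⊆ s → p ∪ q ⊆ s
∪-lub {p = p} {q} p⊆s q⊆s x∈p∪q with x∈p∪q⁻ p q x∈p∪q
... | inj₁ x∈p = p⊆s x∈p
... | inj₂ x∈q = q⊆s x∈q

x∈p⇒⁅x⁆⊆p : {x : Fin n} {p : Subset n} → x ∈ p → ⁅ x ⁆ ⊆ p
x∈p⇒⁅x⁆⊆p {x = x} {p} x∈p y∈⁅x⁆ = subst (_∈ p) (sym (x∈⁅y⁆⇒x≡y x y∈⁅x⁆)) x∈p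

⊆∁⇒disjoint : {p q : Subset n} → p ⊆ ∁ q → Empty (q ∩ p)
⊆∁⇒disjoint {p = p} {q} p⊆∁q (x , x∈q∩p) with x∈p∩q⁻ q p x∈q∩p
... | x∈q , x∈p = x∈p⇒x∉∁p x∈q (p⊆∁q x∈p)

-- Room for a is what 2 + ∣T ∩ T'∣ ≤ ∣T∣
-- guarantees.
exchangeTail : (T T' : Subset n) {r : ℕ} {u a : Fin n} → u ∈ T' → u ∉ T → a ∈ T →
               ∣ T ∣ ≡ r → 2 + ∣ T ∩ T' ∣ ≤ r →
               Σ (Subset n) λ T″ → ∣ T″ ∣ ≡ r × T″ ⊆ T ∪ ⁅ u ⁆ × a ∈ T″
                                 × suc ∣ T ∩ T' ∣ ≤ ∣ T″ ∩ T' ∣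
exchangeTail {n} T T' {r} {u} {a} u∈T' u∉T a∈T ∣T∣≡r short =
  refine (intermediateSubset R X r R⊆X ∣R∣≤r r≤∣X∣)
  where
  B R X : Subset n
  B = (T ∩ T') ∪ ⁅ u ⁆
  R = B ∪ ⁅ a ⁆
  X = T ∪ ⁅ u ⁆
  ∣B∣≡1+∣T∩T'∣ : ∣ B ∣ ≡ suc ∣ T ∩ T' ∣
  ∣B∣≡1+∣T∩T'∣ = x∉p⇒∣p∪⁅x⁆∣≡1+∣p∣ (T ∩ T') (u∉T ∘ p∩q⊆p T T')
  B⊆T' : B ⊆ T'
  B⊆T' = ∪-lub (p∩q⊆q T T') (x∈p⇒⁅x⁆⊆p u∈T')
  R⊆X : R ⊆ X
  R⊆X = ∪-lub (∪-lub (p⊆p∪q ⁅ u ⁆ ∘ p∩q⊆p T T') (q⊆p∪q T ⁅ u ⁆))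
              (p⊆p∪q ⁅ u ⁆ ∘ x∈p⇒⁅x⁆⊆p a∈T)
  ∣R∣≤r : ∣ R ∣ ≤ r
  ∣R∣≤r = ≤-trans (∣p∪⁅x⁆∣≤1+∣p∣ B a) (subst (λ m → suc m ≤ r) (sym ∣B∣≡1+∣T∩T'∣) short)
  r≤∣X∣ : r ≤ ∣ X ∣
  r≤∣X∣ = subst (_≤ ∣ X ∣) ∣T∣≡r (∣p∣≤∣p∪q∣ T ⁅ u ⁆)
  refine : (Σ (Subset n) λ T″ → R ⊆ T″ × T″ ⊆ X × ∣ T″ ∣ ≡ r) →
           Σ (Subset n) λ T″ → ∣ T″ ∣ ≡ r × T″ ⊆ X × a ∈ T″ × suc ∣ T ∩ T' ∣ ≤ ∣ T″ ∩ T' ∣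
  refine (T″ , R⊆T″ , T″⊆X , ∣T″∣≡r) =
    T″ , ∣T″∣≡r , T″⊆X , R⊆T″ (q⊆p∪q B ⁅ a ⁆ (x∈⁅x⁆ a)) ,
    subst (_≤ ∣ T″ ∩ T' ∣) ∣B∣≡1+∣T∩T'∣
      (p⊆q⇒∣p∣≤∣q∣ λ x∈B → x∈p∩q⁺ (R⊆T″ (p⊆p∪q ⁅ a ⁆ x∈B) , B⊆T' x∈B))

module _ {n r : ℕ} where

  Walk : Vertex n r → Vertex n r → Set
  Walk = Star (Adj {n} {r})

  tailNonempty : 0 < r → (x : Vertex n r) → Nonempty (tail x)
  tailNonempty 0<r x = ∣p∣>0⇒Nonempty (tail x) (subst (0 <_) (sym (tailCard x)) 0<r)

  neighbourWithin : (x : Vertex n r) {a : Fin n} → a ∈ tail x →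
                    (R X : Subset n) → R ⊆ X → X ⊆ ∁ (tail x) → head x ∈ R →
                    ∣ R ∣ ≤ r → r ≤ ∣ X ∣ →
                    Σ (Vertex n r) λ z → Adj x z × head z ≡ a × R ⊆ tail z × tail z ⊆ X
  neighbourWithin x {a} a∈T R X R⊆X X⊆∁T h∈R ∣R∣≤r r≤∣X∣
    with intermediateSubset R X r R⊆X ∣R∣≤r r≤∣X∣
  ... | S , R⊆S , S⊆X , ∣S∣≡r =
    vtx a S ∣S∣≡r a∉S , (R⊆S h∈R , a∈T , ⊆∁⇒disjoint S⊆∁T) , refl , R⊆S , S⊆X
    where
    S⊆∁T : S ⊆ ∁ (tail x)
    S⊆∁T = X⊆∁T ∘ S⊆X
    a∉S : a ∉ S
    a∉S a∈S = x∈p⇒x∉∁p a∈T (S⊆∁T a∈S)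

  module _ (n≥2r+1 : 2 * r + 1 ≤ n) where

    room : (A : Subset n) → ∣ A ∣ ≤ suc r → r ≤ ∣ ∁ A ∣
    room A ∣A∣≤1+r = subst (r ≤_) (sym (∣∁p∣≡n∸∣p∣ A))
                       (m+n≤o⇒m≤o∸n r (≤-trans (+-monoʳ-≤ r ∣A∣≤1+r) r+1+r≤n))
      where
      -- 2r + 1 = r + (r + 1)
      r+1+r≤n : r + suc r ≤ n
      r+1+r≤n = subst (_≤ n) (trans (+-comm (2 * r) 1)
                  (trans (cong (λ m → suc (r + m)) (+-identityʳ r)) (sym (+-suc r r)))) n≥2r+1

    -- Two vertices with the same head h, a common tail element a and tails
    -- spanning at most r+1 points are joined through (a , S), where S ∋ h
    -- avoids both tails.
    twoStep : (x y : Vertex n r) → head x ≡ head y → {a : Fin n} →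
              a ∈ tail x → a ∈ tail y → ∣ tail x ∪ tail y ∣ ≤ suc r → Walk x y
    twoStep x y hx≡hy {a} a∈x a∈y ∣T∪T'∣≤1+r =
      throughMiddle (neighbourWithin x a∈x ⁅ head x ⁆ (∁ (tail x ∪ tail y)) (x∈p⇒⁅x⁆⊆p h∉T∪T')
                       (p⊆q⇒∁p⊇∁q (p⊆p∪q (tail y))) (x∈⁅x⁆ (head x)) ∣⁅h⁆∣≤r (room (tail x ∪ tail y) ∣T∪T'∣≤1+r))
      where
      h∉T∪T' : head x ∈ ∁ (tail x ∪ tail y)
      h∉T∪T' = x∉p⇒x∈∁p λ h∈T∪T' → [ headNotInTail x
                                      , headNotInTail y ∘ subst (_∈ tail y) hx≡hy
                                      ]′ (x∈p∪q⁻ (tail x) (tail y) h∈T∪T')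
      -- r ≥ 1 because tail x has the element a
      ∣⁅h⁆∣≤r : ∣ ⁅ head x ⁆ ∣ ≤ r
      ∣⁅h⁆∣≤r = begin
        ∣ ⁅ head x ⁆ ∣ ≡⟨ trans (∣⁅x⁆∣≡1 (head x)) (sym (∣⁅x⁆∣≡1 a)) ⟩
        ∣ ⁅ a ⁆ ∣      ≤⟨ p⊆q⇒∣p∣≤∣q∣ (x∈p⇒⁅x⁆⊆p a∈x) ⟩
        ∣ tail x ∣     ≡⟨ tailCard x ⟩
        r              ∎
        where open ≤-Reasoning
      throughMiddle : (Σ (Vertex n r) λ z → Adj x z × head z ≡ a × ⁅ head x ⁆ ⊆ tail z
                                          × tail z ⊆ ∁ (tail x ∪ tail y)) → Walk x y
      throughMiddle (z , x~z , refl , ⁅h⁆⊆S , S⊆∁T∪T') = _◅_ {j = z} x~z (z~y ◅ ε)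
        where
        z~y : Adj z y
        z~y = a∈y , subst (_∈ tail z) hx≡hy (⁅h⁆⊆S (x∈⁅x⁆ (head x)))
            , subst Empty (∩-comm (tail y) (tail z))
                (⊆∁⇒disjoint (p⊆q⇒∁p⊇∁q (q⊆p∪q (tail x) (tail y)) ∘ S⊆∁T∪T'))

    tailRoom : (x : Vertex n r) → r ≤ ∣ ∁ (tail x) ∣
    tailRoom x = room (tail x) (≤-trans (≤-reflexive (tailCard x)) (n≤1+n r))

    exchangeStep : (x y : Vertex n r) → head x ≡ head y → 2 + ∣ tail x ∩ tail y ∣ ≤ r →
                   Σ (Vertex n r) λ x′ → head x′ ≡ head y × Walk x x′
                                       × suc ∣ tail x ∩ tail y ∣ ≤ ∣ tail x′ ∩ tail y ∣
    exchangeStep x y hx≡hy short = step missing (tailNonempty (≤-trans (s≤s z≤n) short) x)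
      where
      -- tail y has a point outside tail x, as ∣tail y ∩ tail x∣ < r = ∣tail y∣
      missing : ∃ λ u → u ∈ tail y × u ∉ tail x
      missing = ∣p∩q∣<∣p∣⇒p⊈q (tail y) (tail x)
        (subst₂ _<_ (cong ∣_∣ (∩-comm (tail x) (tail y))) (sym (tailCard y)) (≤-trans (n≤1+n _) short))
      step : (∃ λ u → u ∈ tail y × u ∉ tail x) → Nonempty (tail x) →
             Σ (Vertex n r) λ x′ → head x′ ≡ head y × Walk x x′
                                 × suc ∣ tail x ∩ tail y ∣ ≤ ∣ tail x′ ∩ tail y ∣
      step (u , u∈T' , u∉T) (a , a∈T)
        with exchangeTail (tail x) (tail y) u∈T' u∉T a∈T (tailCard x) short
      ... | T″ , ∣T″∣≡r , T″⊆T∪u , a∈T″ , closer =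
        x′ , hx≡hy , twoStep x x′ refl a∈T a∈T″ ∣T∪T″∣≤1+r , closer
        where
        h∉T∪u : head x ∉ tail x ∪ ⁅ u ⁆
        h∉T∪u h∈T∪u = [ headNotInTail x
                      , (λ h∈⁅u⁆ → headNotInTail y (subst (_∈ tail y)
                                     (trans (sym (x∈⁅y⁆⇒x≡y u h∈⁅u⁆)) hx≡hy) u∈T'))
                      ]′ (x∈p∪q⁻ (tail x) ⁅ u ⁆ h∈T∪u)
        x′ : Vertex n r
        x′ = vtx (head x) T″ ∣T″∣≡r (h∉T∪u ∘ T″⊆T∪u)
        ∣T∪T″∣≤1+r : ∣ tail x ∪ T″ ∣ ≤ suc r
        ∣T∪T″∣≤1+r = begin
          ∣ tail x ∪ T″ ∣     ≤⟨ p⊆q⇒∣p∣≤∣q∣ (∪-lub (p⊆p∪q ⁅ u ⁆) T″⊆T∪u) ⟩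
          ∣ tail x ∪ ⁅ u ⁆ ∣ ≤⟨ ∣p∪⁅x⁆∣≤1+∣p∣ (tail x) u ⟩
          suc ∣ tail x ∣      ≡⟨ cong suc (tailCard x) ⟩
          suc r               ∎
          where open ≤-Reasoning

    module _ (r≥2 : 2 ≤ r) where

      ∣⁅i⁆∣≤r : (i : Fin n) → ∣ ⁅ i ⁆ ∣ ≤ r
      ∣⁅i⁆∣≤r i = ≤-trans (≤-reflexive (∣⁅x⁆∣≡1 i)) (≤-trans (n≤1+n 1) r≥2)

      -- Same head, tails sharing at least r - 1 ≥ 1 points: then the tails
      -- span at most r + 1 points and twoStep applies.
      sameHeadClose : (x y : Vertex n r) → head x ≡ head y →
                      r ≤ suc ∣ tail x ∩ tail y ∣ → Walk x y
      sameHeadClose x y hx≡hy r≤1+∣I∣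
        with ∣p∣>0⇒Nonempty (tail x ∩ tail y) (s≤s⁻¹ (≤-trans r≥2 r≤1+∣I∣))
      ... | a , a∈I = twoStep x y hx≡hy (proj₁ (x∈p∩q⁻ _ _ a∈I)) (proj₂ (x∈p∩q⁻ _ _ a∈I))
                        (+-cancelʳ-≤ ∣ tail x ∩ tail y ∣ _ _ ∣T∪T'∣+∣I∣≤1+r+∣I∣)
        where
        ∣T∪T'∣+∣I∣≤1+r+∣I∣ : ∣ tail x ∪ tail y ∣ + ∣ tail x ∩ tail y ∣ ≤ suc r + ∣ tail x ∩ tail y ∣
        ∣T∪T'∣+∣I∣≤1+r+∣I∣ = begin
          ∣ tail x ∪ tail y ∣ + ∣ tail x ∩ tail y ∣ ≡⟨ ∣p∪q∣+∣p∩q∣≡∣p∣+∣q∣ (tail x) (tail y) ⟩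
          ∣ tail x ∣ + ∣ tail y ∣                     ≡⟨ cong₂ _+_ (tailCard x) (tailCard y) ⟩
          r + r                                       ≤⟨ +-monoʳ-≤ r r≤1+∣I∣ ⟩
          r + suc ∣ tail x ∩ tail y ∣                 ≡⟨ +-suc r _ ⟩
          suc r + ∣ tail x ∩ tail y ∣                 ∎
          where open ≤-Reasoning

      -- Any two vertices with the same head are joined by a walk; induction
      -- on the number d of points the tails' intersection may still lack.
      sameHead : (d : ℕ) (x y : Vertex n r) → head x ≡ head y →
                 r ≤ d + ∣ tail x ∩ tail y ∣ → Walk x y
      sameHead d x y hx≡hy r≤d+∣I∣ = byDistance d (r ≤? suc ∣ tail x ∩ tail y ∣) r≤d+∣I∣
        where
        byDistance : (d : ℕ) → Dec (r ≤ suc ∣ tail x ∩ tail y ∣) → r ≤ d + ∣ tail x ∩ tail y ∣ → Walk x y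
        byDistance _ (yes close) _ = sameHeadClose x y hx≡hy close
        byDistance zero (no far) r≤∣I∣ = contradiction (≤-trans r≤∣I∣ (n≤1+n ∣ tail x ∩ tail y ∣)) far
        byDistance (suc d) (no far) r≤1+d+∣I∣ = continue (exchangeStep x y hx≡hy (≰⇒> far))
          where
          continue : (Σ (Vertex n r) λ x′ → head x′ ≡ head y × Walk x x′
                                          × suc ∣ tail x ∩ tail y ∣ ≤ ∣ tail x′ ∩ tail y ∣) → Walk x y
          continue (x′ , hx′≡hy , x⇝x′ , closer) =
            x⇝x′ ◅◅ sameHead d x′ y hx′≡hy
                      (≤-trans r≤1+d+∣I∣ (≤-trans (≤-reflexive (sym (+-suc d ∣ tail x ∩ tail y ∣)))
                                                   (+-monoʳ-≤ d closer)))

      -- A vertex reaches every vertex whose head lies in its tail: step to a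
      -- neighbour with that head, then use sameHead.
      headInTail : (x y : Vertex n r) → head y ∈ tail x → Walk x y
      headInTail x y hy∈T
        with neighbourWithin x hy∈T ⁅ head x ⁆ (∁ (tail x)) (x∈p⇒⁅x⁆⊆p (x∉p⇒x∈∁p (headNotInTail x)))
               id (x∈⁅x⁆ (head x)) (∣⁅i⁆∣≤r (head x)) (tailRoom x)
      ... | z , x~z , hz≡hy , _ = x~z ◅ sameHead r z y hz≡hy (m≤m+n r _)

      -- If head y ∉ tail x, first step to a neighbour whose tail contains both
      -- head x and head y (two prescribed points, hence r ≥ 2), then headInTail.
      connected : Connected n r
      connected x y with head y ∈? tail x
      ... | yes hy∈T = headInTail x y hy∈T
      ... | no hy∉T with tailNonempty (≤-trans (s≤s z≤n) r≥2) x
      ...   | a , a∈T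
        with neighbourWithin x a∈T (⁅ head x ⁆ ∪ ⁅ head y ⁆) (∁ (tail x))
               (∪-lub (x∈p⇒⁅x⁆⊆p (x∉p⇒x∈∁p (headNotInTail x))) (x∈p⇒⁅x⁆⊆p (x∉p⇒x∈∁p hy∉T)))
               id (p⊆p∪q ⁅ head y ⁆ (x∈⁅x⁆ (head x)))
               (≤-trans (∣p∪⁅x⁆∣≤1+∣p∣ ⁅ head x ⁆ (head y))
                        (subst (λ m → suc m ≤ r) (sym (∣⁅x⁆∣≡1 (head x))) r≥2))
               (tailRoom x)
      ...     | z , x~z , _ , ⁅hx,hy⁆⊆S , _ =
        x~z ◅ headInTail z y (⁅hx,hy⁆⊆S (q⊆p∪q ⁅ head x ⁆ ⁅ head y ⁆ (x∈⁅x⁆ (head y))))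

mainTheorem7 : (n r : ℕ) → 2 ≤ r → 2 * r + 1 ≤ n → Connected n r
mainTheorem7 n r r≥2 n≥2r+1 = connected n≥2r+1 r≥2
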